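{- Let $G$ be a graph and $ab$ an edge of $G$. If every induced subgraph of $G$ isomorphic to $P_4$ contains the edge $ab$, and $ab$ lies in no cycle of $G$, then $G-ab$ is a cograph.
   Context: All graphs are finite, simple and undirected. $P_4$ is the path on four vertices. A cograph is a graph with no induced subgraph isomorphic to $P_4$ (equivalently, a graph generated from $K_1$ by complementation and disjoint union). $G-ab$ denotes the graph obtained by deleting the edge $ab$ (keeping all vertices). -}

module Defs where

open import Data.Nat using (ℕ; zero; suc)
open import Data.Fin using (Fin; zero; suc)
open import Data.Product using (Σ; _×_; _,_; ∃)
open import Data.Sum using (_⊎_)
open import Relation.Nullary using (¬_; Dec)
open import Relation.Binary.PropositionalEquality using (_≡_; _≢_)
open import Function.Definitions using (Injective)

record Graph (n : ℕ) : Set₁ where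
  field
    Adj    : Fin n → Fin n → Set
    adj?   : ∀ x y → Dec (Adj x y)
    sym    : ∀ {x y} → Adj x y → Adj y x
    irrefl : ∀ {x} → ¬ Adj x x
open Graph public

SamePair : ∀ {n} → Fin n → Fin n → Fin n → Fin n → Set
SamePair x y a b = (x ≡ a × y ≡ b) ⊎ (x ≡ b × y ≡ a)

deleteEdge : ∀ {n} → Graph n → Fin n → Fin n → Graph n
deleteEdge {n} G a b = record
  { Adj    = λ x y → Adj G x y × ¬ SamePair x y a b
  ; adj?   = dec
  ; sym    = λ { (e , ne) → sym G e , λ p → ne (swap p) }
  ; irrefl = λ { (e , _) → irrefl G e }
  }
  where
  open import Relation.Nullary using (yes; no)
  open import Data.Sum using (inj₁; inj₂)
  open import Data.Fin using (_≟_)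
  open import Relation.Nullary.Decidable using (_×-dec_; _⊎-dec_; ¬?)
  swap : ∀ {x y} → SamePair y x a b → SamePair x y a b
  swap (inj₁ (p , q)) = inj₂ (q , p)
  swap (inj₂ (p , q)) = inj₁ (q , p)
  dec : ∀ x y → Dec (Adj G x y × ¬ SamePair x y a b)
  dec x y = adj? G x y ×-dec ¬? (((x ≟ a) ×-dec (y ≟ b)) ⊎-dec ((x ≟ b) ×-dec (y ≟ a)))

record InducedP4 {n} (G : Graph n) : Set where
  field
    v0 v1 v2 v3 : Fin n
    d01 : v0 ≢ v1
    d02 : v0 ≢ v2
    d03 : v0 ≢ v3
    d12 : v1 ≢ v2
    d13 : v1 ≢ v3
    d23 : v2 ≢ v3
    e01 : Adj G v0 v1
    e12 : Adj G v1 v2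
    e23 : Adj G v2 v3
    n02 : ¬ Adj G v0 v2
    n13 : ¬ Adj G v1 v3
    n03 : ¬ Adj G v0 v3
open InducedP4 public

InP4 : ∀ {n} {G : Graph n} → InducedP4 G → Fin n → Set
InP4 P x = (x ≡ v0 P) ⊎ (x ≡ v1 P) ⊎ (x ≡ v2 P) ⊎ (x ≡ v3 P)

-- the induced subgraph on the P4's vertices contains the edge ab
-- (ab being an edge of G, this holds iff both a and b are vertices of the P4)
P4ContainsEdge : ∀ {n} {G : Graph n} → InducedP4 G → Fin n → Fin n → Set
P4ContainsEdge P a b = InP4 P a × InP4 P b

IsCograph : ∀ {n} → Graph n → Set
IsCograph G = ¬ InducedP4 G

-- cyclic successor on Fin (suc m): i ↦ i+1 mod (suc m)
next : ∀ {m} → Fin (suc m) → Fin (suc m)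
next {zero}  zero    = zero
next {suc m} zero    = suc zero
next {suc m} (suc i) with next {m} i
... | zero  = zero
... | suc j = suc (suc j)

-- a cycle of length k+3 ≥ 3: distinct vertices c 0, …, c (k+2) with
-- c i adjacent to c (i+1 mod k+3)
record Cycle {n} (G : Graph n) : Set where
  field
    k    : ℕ
    c    : Fin (suc (suc (suc k))) → Fin n
    inj  : Injective _≡_ _≡_ c
    adjs : ∀ i → Adj G (c i) (c (next i))
open Cycle public

EdgeOnCycle : ∀ {n} {G : Graph n} → Cycle G → Fin n → Fin n → Set
EdgeOnCycle C a b = ∃ λ i → SamePair (c C i) (c C (next i)) a b

{-# OPTIONS --safe #-}
-- Let P be an induced P4 of G − ab. If {a,b} is one of the three non-adjacent
-- pairs of P, the edge ab closes a subpath of P into a triangle or a 4-cycle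
-- of G. Otherwise P is also an induced P4 of G, so it contains a and b; but
-- the only adjacent pairs of an induced P4 are its path edges, and those of
-- P are edges of G − ab, so none of them is ab.
module Submission where

open import Defs
open import Data.Nat using (ℕ; _+_)
open import Data.Fin using (Fin; zero; suc; #_; _≟_)
open import Data.Vec using (Vec; []; _∷_; lookup)
open import Data.Vec.Relation.Unary.Unique.Propositional using (Unique)
open import Data.Vec.Relation.Unary.Unique.Propositional.Properties using (lookup-injective)
open import Data.Vec.Relation.Unary.AllPairs using ([]; _∷_)
open import Data.Vec.Relation.Unary.All using ([]; _∷_)
open import Data.Product using (_,_; ∃; proj₁; proj₂; uncurry)
open import Data.Sum using (_⊎_; inj₁; inj₂; [_,_]′)
open import Data.Empty using (⊥-elim)
open import Function using (_∘_)
open import Relation.Nullary using (¬_; Dec; yes; no)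
open import Relation.Nullary.Decidable using (_×-dec_; _⊎-dec_)
open import Relation.Binary.PropositionalEquality using (_≢_; refl)

private
  variable
    n : ℕ
    G : Graph n
    a b x y z w : Fin n

SamePair-swap : SamePair x y a b → SamePair y x a b
SamePair-swap (inj₁ (p , q)) = inj₂ (q , p)
SamePair-swap (inj₂ (p , q)) = inj₁ (q , p)

SamePair-adj : SamePair x y a b → Adj G a b → Adj G x y
SamePair-adj (inj₁ (refl , refl)) ab = ab
SamePair-adj {G = G} (inj₂ (refl , refl)) ab = sym G ab

samePair? : (x y a b : Fin n) → Dec (SamePair x y a b)
samePair? x y a b = ((x ≟ a) ×-dec (y ≟ b)) ⊎-dec ((x ≟ b) ×-dec (y ≟ a))

cycle : ∀ {k} (vs : Vec (Fin n) (3 + k)) → Unique vs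
      → (∀ i → Adj G (lookup vs i) (lookup vs (next i))) → Cycle G
cycle vs distinct adjs = record
  { k = _ ; c = lookup vs ; inj = lookup-injective distinct _ _ ; adjs = adjs }

triangle : x ≢ y → x ≢ z → y ≢ z
         → Adj G x y → Adj G y z → Adj G z x → Cycle G
triangle {x = x} {y} {z} x≢y x≢z y≢z xy yz zx =
  cycle (x ∷ y ∷ z ∷ [])
        ((x≢y ∷ x≢z ∷ []) ∷ (y≢z ∷ []) ∷ [] ∷ [])
        λ { zero → xy ; (suc zero) → yz ; (suc (suc zero)) → zx }

square : x ≢ y → x ≢ z → x ≢ w → y ≢ z → y ≢ w → z ≢ w
       → Adj G x y → Adj G y z → Adj G z w → Adj G w x → Cycle G
square {x = x} {y} {z} {w} x≢y x≢z x≢w y≢z y≢w z≢w xy yz zw wx =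
  cycle (x ∷ y ∷ z ∷ w ∷ [])
        ((x≢y ∷ x≢z ∷ x≢w ∷ []) ∷ (y≢z ∷ y≢w ∷ []) ∷ (z≢w ∷ []) ∷ [] ∷ [])
        λ { zero → xy ; (suc zero) → yz ; (suc (suc zero)) → zw ; (suc (suc (suc zero))) → wx }

P4PathEdge : {G : Graph n} → InducedP4 G → Fin n → Fin n → Set
P4PathEdge P x y =
  SamePair (v0 P) (v1 P) x y ⊎ SamePair (v1 P) (v2 P) x y ⊎ SamePair (v2 P) (v3 P) x y

P4NonEdge : {G : Graph n} → InducedP4 G → Fin n → Fin n → Set
P4NonEdge P x y =
  SamePair (v0 P) (v2 P) x y ⊎ SamePair (v1 P) (v3 P) x y ⊎ SamePair (v0 P) (v3 P) x y

P4NonEdge? : {G : Graph n} (P : InducedP4 G) (x y : Fin n) → Dec (P4NonEdge P x y)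
P4NonEdge? P x y =
  samePair? (v0 P) (v2 P) x y ⊎-dec samePair? (v1 P) (v3 P) x y ⊎-dec samePair? (v0 P) (v3 P) x y

adj⇒P4PathEdge : (P : InducedP4 G) → InP4 P x → InP4 P y → Adj G x y → P4PathEdge P x y
adj⇒P4PathEdge {G = G} P = edge
  where
  edge : InP4 P x → InP4 P y → Adj G x y → P4PathEdge P x y
  edge (inj₁ refl)               (inj₁ refl)               e = ⊥-elim (irrefl G e)
  edge (inj₁ refl)               (inj₂ (inj₁ refl))        _ = inj₁ (inj₁ (refl , refl))
  edge (inj₁ refl)               (inj₂ (inj₂ (inj₁ refl))) e = ⊥-elim (n02 P e)
  edge (inj₁ refl)               (inj₂ (inj₂ (inj₂ refl))) e = ⊥-elim (n03 P e)
  edge (inj₂ (inj₁ refl))        (inj₁ refl)               _ = inj₁ (inj₂ (refl , refl))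
  edge (inj₂ (inj₁ refl))        (inj₂ (inj₁ refl))        e = ⊥-elim (irrefl G e)
  edge (inj₂ (inj₁ refl))        (inj₂ (inj₂ (inj₁ refl))) _ = inj₂ (inj₁ (inj₁ (refl , refl)))
  edge (inj₂ (inj₁ refl))        (inj₂ (inj₂ (inj₂ refl))) e = ⊥-elim (n13 P e)
  edge (inj₂ (inj₂ (inj₁ refl))) (inj₁ refl)               e = ⊥-elim (n02 P (sym G e))
  edge (inj₂ (inj₂ (inj₁ refl))) (inj₂ (inj₁ refl))        _ = inj₂ (inj₁ (inj₂ (refl , refl)))
  edge (inj₂ (inj₂ (inj₁ refl))) (inj₂ (inj₂ (inj₁ refl))) e = ⊥-elim (irrefl G e)
  edge (inj₂ (inj₂ (inj₁ refl))) (inj₂ (inj₂ (inj₂ refl))) _ = inj₂ (inj₂ (inj₁ (refl , refl)))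
  edge (inj₂ (inj₂ (inj₂ refl))) (inj₁ refl)               e = ⊥-elim (n03 P (sym G e))
  edge (inj₂ (inj₂ (inj₂ refl))) (inj₂ (inj₁ refl))        e = ⊥-elim (n13 P (sym G e))
  edge (inj₂ (inj₂ (inj₂ refl))) (inj₂ (inj₂ (inj₁ refl))) _ = inj₂ (inj₂ (inj₂ (refl , refl)))
  edge (inj₂ (inj₂ (inj₂ refl))) (inj₂ (inj₂ (inj₂ refl))) e = ⊥-elim (irrefl G e)

module _ {n} (G : Graph n) (a b : Fin n) where

  deleteEdge-¬P4PathEdge : (P : InducedP4 (deleteEdge G a b)) → ¬ P4PathEdge P a b
  deleteEdge-¬P4PathEdge P = [ proj₂ (e01 P) , [ proj₂ (e12 P) , proj₂ (e23 P) ]′ ]′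

  liftInducedP4 : (P : InducedP4 (deleteEdge G a b)) → ¬ P4NonEdge P a b → InducedP4 G
  liftInducedP4 P ¬ne = record
    { v0 = v0 P ; v1 = v1 P ; v2 = v2 P ; v3 = v3 P
    ; d01 = d01 P ; d02 = d02 P ; d03 = d03 P ; d12 = d12 P ; d13 = d13 P ; d23 = d23 P
    ; e01 = proj₁ (e01 P) ; e12 = proj₁ (e12 P) ; e23 = proj₁ (e23 P)
    ; n02 = λ e → n02 P (e , ¬ne ∘ inj₁)
    ; n13 = λ e → n13 P (e , ¬ne ∘ inj₂ ∘ inj₁)
    ; n03 = λ e → n03 P (e , ¬ne ∘ inj₂ ∘ inj₂)
    }

  P4NonEdge⇒onCycle : Adj G a b → (P : InducedP4 (deleteEdge G a b)) → P4NonEdge P a b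
                    → ∃ λ (C : Cycle G) → EdgeOnCycle C a b
  P4NonEdge⇒onCycle ab P (inj₁ s) =
    triangle (d01 P) (d02 P) (d12 P) (proj₁ (e01 P)) (proj₁ (e12 P)) (SamePair-adj {G = G} (SamePair-swap s) ab)
    , # 2 , SamePair-swap s
  P4NonEdge⇒onCycle ab P (inj₂ (inj₁ s)) =
    triangle (d12 P) (d13 P) (d23 P) (proj₁ (e12 P)) (proj₁ (e23 P)) (SamePair-adj {G = G} (SamePair-swap s) ab)
    , # 2 , SamePair-swap s
  P4NonEdge⇒onCycle ab P (inj₂ (inj₂ s)) =
    square (d01 P) (d02 P) (d03 P) (d12 P) (d13 P) (d23 P)
           (proj₁ (e01 P)) (proj₁ (e12 P)) (proj₁ (e23 P)) (SamePair-adj {G = G} (SamePair-swap s) ab)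
    , # 3 , SamePair-swap s

lemma3p2 : ∀ {n} (G : Graph n) (a b : Fin n) → Adj G a b
         → (∀ (P : InducedP4 G) → P4ContainsEdge P a b)
         → (∀ (C : Cycle G) → ¬ EdgeOnCycle C a b)
         → IsCograph (deleteEdge G a b)
lemma3p2 G a b ab P4s∋ab acyclic P with P4NonEdge? P a b
... | yes ne = uncurry acyclic (P4NonEdge⇒onCycle G a b ab P ne)
... | no ¬ne = deleteEdge-¬P4PathEdge G a b P (adj⇒P4PathEdge P′ a∈P′ b∈P′ ab)
  where
  P′ : InducedP4 G
  P′ = liftInducedP4 G a b P ¬ne
  a∈P′ : InP4 P′ a
  a∈P′ = proj₁ (P4s∋ab P′)
  b∈P′ : InP4 P′ b
  b∈P′ = proj₂ (P4s∋ab P′)
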